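{- Let $n\ge 2$ and let $\mathcal{F}\subset\mathcal{P}([n])$ be a left-compressed up-set which is both $3$-wise intersecting and $3$-intersecting. Let $\mathcal{G}$ be the set of minimal elements of $\mathcal{F}$ and $\mathcal{G}_0=\{A\in\mathcal{G}: n\in A\}$. Suppose there is no $i<n-1$ for which $\mathcal{G}_0$ contains an $(i,n-1)$-sharp pair. Then $w(\mathcal{F})\le W(n-1)$.
   Context: $w(\mathcal{F})=|\mathcal{F}|/2^n$ for $\mathcal{F}\subset\mathcal{P}([n])$. A family is $3$-wise intersecting if any three (not necessarily distinct) members have nonempty common intersection, and $3$-intersecting if any two members intersect in at least $3$ elements. $W(m)$ denotes the maximum of $w(\mathcal{F})$ over all $\mathcal{F}\subset\mathcal{P}([m])$ that are both $3$-wise intersecting and $3$-intersecting. A family is left-compressed if for all $1\le i<j\le n$ and $A\in\mathcal{F}$ with $j\in A$, $i\notin A$, we have $(A\setminus\{j\})\cup\{i\}\in\mathcal{F}$; an up-set is a family closed under taking supersets within $[n]$. For $i<j<n$, an $(i,j)$-sharp pair in $\mathcal{G}_0$ is a pair $(A,B)$ of sets in $\mathcal{G}_0$ with $A\cup B=[n]$ and $A\cap B=\{i,j,n\}$. -}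

module Defs where

open import Data.Nat using (ℕ; zero; suc; _*_; _^_; _≤_; _∸_)
open import Data.Bool using (Bool; true; false)
open import Data.List using (List; []; _∷_; _++_; map; filter; length)
open import Data.Vec using (Vec; []; _∷_)
open import Data.Fin using (Fin; toℕ; fromℕ; _<_)
open import Data.Fin.Subset using (Subset; _∈_; _∉_; _⊆_; _∩_; _∪_; _-_; ⁅_⁆; ⊤; ∣_∣; Nonempty)
open import Data.Product using (_×_; Σ; ∃)
open import Relation.Binary.PropositionalEquality using (_≡_)
open import Relation.Nullary using (¬_)
open import Relation.Unary using (Pred)

-- Ground set [n] is represented by Fin n: element k+1 of [n] is the Fin value k.
-- A family F ⊆ P([n]) is represented by its (decidable) characteristic function.
Family : ℕ → Set
Family n = Subset n → Bool

infix 4 _∈F_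
_∈F_ : ∀ {n} → Subset n → Family n → Set
A ∈F F = F A ≡ true

allSubsets : (n : ℕ) → List (Subset n)
allSubsets zero = [] ∷ []
allSubsets (suc n) = map (true ∷_) (allSubsets n) ++ map (false ∷_) (allSubsets n)

card : ∀ {n} → Family n → ℕ
card {n} F = length (filter (λ A → F A Data.Bool.≟ true) (allSubsets n))

-- w(F) = |F| / 2^n ; we compare weights by cross-multiplication:
-- w(F) ≤ w(G) for F ⊆ P([n]), G ⊆ P([m])  iff  |F| * 2^m ≤ |G| * 2^n
weight≤ : ∀ {n m} → Family n → Family m → Set
weight≤ {n} {m} F G = card F * 2 ^ m ≤ card G * 2 ^ n

ThreeWiseIntersecting : ∀ {n} → Family n → Set
ThreeWiseIntersecting F = ∀ A B C → A ∈F F → B ∈F F → C ∈F F → Nonempty (A ∩ B ∩ C)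

ThreeIntersecting : ∀ {n} → Family n → Set
ThreeIntersecting F = ∀ A B → A ∈F F → B ∈F F → 3 ≤ ∣ A ∩ B ∣

UpSet : ∀ {n} → Family n → Set
UpSet F = ∀ A B → A ∈F F → A ⊆ B → B ∈F F

LeftCompressed : ∀ {n} → Family n → Set
LeftCompressed F = ∀ i j A → i < j → A ∈F F → j ∈ A → i ∉ A → ((A - j) ∪ ⁅ i ⁆) ∈F F

Minimal : ∀ {n} → Family n → Subset n → Set
Minimal F A = A ∈F F × (∀ B → B ∈F F → B ⊆ A → B ≡ A)

-- A ∈ G₀ : A minimal in F and n ∈ A (n is the last element, fromℕ m in Fin (suc m))
InG0 : ∀ {m} → Family (suc m) → Subset (suc m) → Set
InG0 {m} F A = Minimal F A × fromℕ m ∈ A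

SharpPair : ∀ {m} → Family (suc m) → Fin (suc m) → Fin (suc m) → Set
SharpPair {m} F i j =
  Σ (Subset (suc m)) λ A → Σ (Subset (suc m)) λ B →
    InG0 F A × InG0 F B × (A ∪ B ≡ ⊤) × (A ∩ B ≡ ⁅ i ⁆ ∪ ⁅ j ⁆ ∪ ⁅ fromℕ m ⁆)

-- Write n for the last element of the ground set. Deleting n maps the members A of F with
-- [n−1 ∈ A] = [n ∈ A] onto restrictLast id F and the others onto restrictLast not F, two
-- families on [n−1] whose sizes add up to |F|; so the larger one has weight at least w(F),
-- and it remains to see that both are 3-wise intersecting and 3-intersecting.
-- In restrictLast not F, a member containing n but not n−1 may first be replaced, by left
-- compression, by its shift containing n−1 but not n; after that no intersection contains n.
-- In restrictLast id F, deleting n loses an element of an intersection only when the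
-- intersection contains both n−1 and n, and the one harmful case is A₁ ∩ A₂ = {i, n−1, n}.
-- Then minimal members C₁ ⊆ A₁, C₂ ⊆ A₂ still meet in exactly {i, n−1, n}, by
-- 3-intersection, and C₁ ∪ C₂ = [n], since otherwise moving n in C₁ to a missing element
-- gives a member of F meeting C₂ in at most two elements: (C₁, C₂) is an (i, n−1)-sharp pair.

module Submission where

open import Defs
open import Data.Bool using (Bool; true; false; not; _∧_)
import Data.Bool as Bool
open import Data.Bool.Properties using (∧-inverseʳ)
open import Data.Empty using (⊥-elim)
open import Data.Fin using (Fin; zero; suc; toℕ; fromℕ; inject₁; _<_)
open import Data.Fin.Properties using (toℕ-fromℕ; toℕ-inject₁; toℕ<n; ≤fromℕ; ℕ<⇒inject₁<)
import Data.Fin.Properties as Finₚ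
open import Data.Fin.Subset
open import Data.Fin.Subset.Properties
open import Data.List using (List; []; _∷_; _++_; map; filter; length)
open import Data.List.Properties using (filter-++; length-++; filter-≐)
open import Data.Nat using (ℕ; zero; suc; _+_; _*_; _^_; _≤_; _∸_; _≤?_; z≤n; s≤s; s≤s⁻¹)
import Data.Nat as ℕ
open import Data.Nat.Properties
open import Algebra.Properties.CommutativeSemigroup +-commutativeSemigroup using (interchange)
open import Data.Nat.Solver using (module +-*-Solver)
open import Data.Product using (Σ; ∃; _×_; _,_; proj₁; proj₂)
open import Data.Sum using (inj₁; inj₂)
open import Data.Vec using ([]; _∷_; _∷ʳ_; last; initLast; here; there)
open import Data.Vec.Properties using (last-∷ʳ)
open import Function using (_∘_; id)
open import Relation.Binary.PropositionalEquality
open import Relation.Nullary using (¬_; does; yes; no)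
open import Relation.Nullary.Decidable using (_×-dec_)
open import Relation.Unary using (Pred; Decidable)

x∉p-x : ∀ {n} (p : Subset n) x → x ∉ p - x
x∉p-x (_ ∷ p) zero    ()
x∉p-x (_ ∷ p) (suc x) (there h) = x∉p-x p x h

∣p∪q∣≤∣p∣+∣q∣ : ∀ {n} (p q : Subset n) → ∣ p ∪ q ∣ ≤ ∣ p ∣ + ∣ q ∣
∣p∪q∣≤∣p∣+∣q∣ []          []          = z≤n
∣p∪q∣≤∣p∣+∣q∣ (true ∷ p)  (y ∷ q)     = s≤s (≤-trans (∣p∪q∣≤∣p∣+∣q∣ p q) (+-monoʳ-≤ ∣ p ∣ (∣p∣≤∣x∷p∣ y q)))
∣p∪q∣≤∣p∣+∣q∣ (false ∷ p) (true ∷ q)  = ≤-trans (s≤s (∣p∪q∣≤∣p∣+∣q∣ p q)) (≤-reflexive (sym (+-suc ∣ p ∣ ∣ q ∣)))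
∣p∪q∣≤∣p∣+∣q∣ (false ∷ p) (false ∷ q) = ∣p∪q∣≤∣p∣+∣q∣ p q

p⊆q∧p⊄q⇒p≡q : ∀ {n} {p q : Subset n} → p ⊆ q → ¬ p ⊂ q → p ≡ q
p⊆q∧p⊄q⇒p≡q {p = p} {q} p⊆q p⊄q = ⊆-antisym p⊆q q⊆p
  where
  q⊆p : q ⊆ p
  q⊆p {x} x∈q with x ∈? p
  ... | yes x∈p = x∈p
  ... | no  x∉p = ⊥-elim (p⊄q (p⊆q , x , x∈q , x∉p))

p⊆q∧∣q∣≤∣p∣⇒p≡q : ∀ {n} {p q : Subset n} → p ⊆ q → ∣ q ∣ ≤ ∣ p ∣ → p ≡ q
p⊆q∧∣q∣≤∣p∣⇒p≡q p⊆q ∣q∣≤∣p∣ = p⊆q∧p⊄q⇒p≡q p⊆q (λ p⊂q → <⇒≱ (p⊂q⇒∣p∣<∣q∣ p⊂q) ∣q∣≤∣p∣)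

∣p∣≡0⇒p≡⊥ : ∀ {n} {p : Subset n} → ∣ p ∣ ≡ 0 → p ≡ ⊥
∣p∣≡0⇒p≡⊥ {p = []}        _ = refl
∣p∣≡0⇒p≡⊥ {p = false ∷ p} e = cong (false ∷_) (∣p∣≡0⇒p≡⊥ e)
∣p∣≡0⇒p≡⊥ {p = true ∷ p}  ()

∣p∣≡1⇒p≡⁅x⁆ : ∀ {n} {p : Subset n} → ∣ p ∣ ≡ 1 → ∃ λ x → p ≡ ⁅ x ⁆
∣p∣≡1⇒p≡⁅x⁆ {p = true ∷ p}  e = zero , cong (true ∷_) (∣p∣≡0⇒p≡⊥ (suc-injective e))
∣p∣≡1⇒p≡⁅x⁆ {p = false ∷ p} e = let x , p≡⁅x⁆ = ∣p∣≡1⇒p≡⁅x⁆ e in suc x , cong (false ∷_) p≡⁅x⁆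

⊆-minimal : ∀ {n} (F : Family n) {A} → A ∈F F → Σ (Subset n) λ C → C ⊆ A × Minimal F C
⊆-minimal {n} F {A} A∈F = go (suc ∣ A ∣) A ≤-refl A∈F
  where
  go : (bound : ℕ) → ∀ A → ∣ A ∣ ℕ.< bound → A ∈F F → Σ (Subset n) λ C → C ⊆ A × Minimal F C
  go (suc bound) A ∣A∣<bound A∈F
    with anySubset? {P = λ B → B ∈F F × B ⊂ A} (λ B → (F B Bool.≟ true) ×-dec (B ⊂? A))
  ... | yes (B , B∈F , B⊂A) =
    let C , C⊆B , minC = go bound B (≤-trans (p⊂q⇒∣p∣<∣q∣ B⊂A) (≤-pred ∣A∣<bound)) B∈F
    in C , ⊆-trans C⊆B (p⊂q⇒p⊆q B⊂A) , minC
  ... | no ∄B = A , ⊆-refl , A∈F , λ B B∈F B⊆A → p⊆q∧p⊄q⇒p≡q B⊆A (λ B⊂A → ∄B (B , B∈F , B⊂A))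

length-filter-map : ∀ {a b p} {A : Set a} {B : Set b} {P : Pred B p} (P? : Decidable P) (f : A → B) (xs : List A) →
  length (filter P? (map f xs)) ≡ length (filter (P? ∘ f) xs)
length-filter-map P? f [] = refl
length-filter-map P? f (x ∷ xs) with does (P? (f x))
... | true = cong suc (length-filter-map P? f xs)
... | false = length-filter-map P? f xs

card-cong : ∀ {n} {F G : Family n} → (∀ A → F A ≡ G A) → card F ≡ card G
card-cong {n} {F} {G} F≗G = cong length (filter-≐ (λ A → F A Bool.≟ true) (λ A → G A Bool.≟ true)
  ((λ {A} → trans (sym (F≗G A))) , (λ {A} → trans (F≗G A))) (allSubsets n))

card-∷ : ∀ {n} (F : Family (suc n)) → card F ≡ card (λ p → F (true ∷ p)) + card (λ p → F (false ∷ p))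
card-∷ {n} F = begin
  length (filter F? (map (true ∷_) S ++ map (false ∷_) S))
    ≡⟨ cong length (filter-++ F? (map (true ∷_) S) (map (false ∷_) S)) ⟩
  length (filter F? (map (true ∷_) S) ++ filter F? (map (false ∷_) S))
    ≡⟨ length-++ (filter F? (map (true ∷_) S)) ⟩
  length (filter F? (map (true ∷_) S)) + length (filter F? (map (false ∷_) S))
    ≡⟨ cong₂ _+_ (length-filter-map F? (true ∷_) S) (length-filter-map F? (false ∷_) S) ⟩
  card (λ p → F (true ∷ p)) + card (λ p → F (false ∷ p)) ∎
  where
  open ≡-Reasoning
  S = allSubsets n
  F? = λ A → F A Bool.≟ true

card-∷ʳ : ∀ {n} (F : Family (suc n)) → card F ≡ card (λ p → F (p ∷ʳ true)) + card (λ p → F (p ∷ʳ false))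
card-∷ʳ {zero} F = trans (card-∷ F) (cong₂ _+_
  (card-cong {F = λ p → F (true ∷ p)}  {G = λ p → F (p ∷ʳ true)}  λ { [] → refl })
  (card-cong {F = λ p → F (false ∷ p)} {G = λ p → F (p ∷ʳ false)} λ { [] → refl }))
card-∷ʳ {suc n} F = begin
  card F                           ≡⟨ card-∷ F ⟩
  card F₁ + card F₀                ≡⟨ cong₂ _+_ (card-∷ʳ F₁) (card-∷ʳ F₀) ⟩
  (c₁₁ + c₁₀) + (c₀₁ + c₀₀)        ≡⟨ interchange c₁₁ c₁₀ c₀₁ c₀₀ ⟩
  (c₁₁ + c₀₁) + (c₁₀ + c₀₀)        ≡⟨ cong₂ _+_ (card-∷ (λ p → F (p ∷ʳ true))) (card-∷ (λ p → F (p ∷ʳ false))) ⟨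
  card (λ p → F (p ∷ʳ true)) + card (λ p → F (p ∷ʳ false)) ∎
  where
  open ≡-Reasoning
  F₁ F₀ : Family (suc n)
  F₁ p = F (true ∷ p)
  F₀ p = F (false ∷ p)
  c₁₁ = card (λ p → F₁ (p ∷ʳ true))
  c₁₀ = card (λ p → F₁ (p ∷ʳ false))
  c₀₁ = card (λ p → F₀ (p ∷ʳ true))
  c₀₀ = card (λ p → F₀ (p ∷ʳ false))

-- restrictLast f F = { A ∖ {n} : A ∈ F, [n ∈ A] = f [n−1 ∈ A] }, where n is the last element.
restrictLast : ∀ {n} → (Bool → Bool) → Family (suc (suc n)) → Family (suc n)
restrictLast f F B = F (B ∷ʳ f (last B))

card-restrictLast : ∀ {n} (f : Bool → Bool) (F : Family (suc (suc n))) →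
  card (restrictLast f F) ≡ card (λ p → F (p ∷ʳ true ∷ʳ f true)) + card (λ p → F (p ∷ʳ false ∷ʳ f false))
card-restrictLast f F = trans (card-∷ʳ (restrictLast f F))
  (cong₂ _+_ (card-cong λ p → cong (λ a → F (p ∷ʳ true ∷ʳ f a)) (last-∷ʳ true p))
             (card-cong λ p → cong (λ a → F (p ∷ʳ false ∷ʳ f a)) (last-∷ʳ false p)))

card≡card-restrictLast : ∀ {n} (F : Family (suc (suc n))) →
  card F ≡ card (restrictLast id F) + card (restrictLast not F)
card≡card-restrictLast F = begin
  card F                     ≡⟨ card-∷ʳ F ⟩
  card F₁ + card F₀          ≡⟨ cong₂ _+_ (card-∷ʳ F₁) (card-∷ʳ F₀) ⟩
  (c₁₁ + c₀₁) + (c₁₀ + c₀₀)  ≡⟨ cong ((c₁₁ + c₀₁) +_) (+-comm c₁₀ c₀₀) ⟩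
  (c₁₁ + c₀₁) + (c₀₀ + c₁₀)  ≡⟨ interchange c₁₁ c₀₁ c₀₀ c₁₀ ⟩
  (c₁₁ + c₀₀) + (c₀₁ + c₁₀)  ≡⟨ cong ((c₁₁ + c₀₀) +_) (+-comm c₀₁ c₁₀) ⟩
  (c₁₁ + c₀₀) + (c₁₀ + c₀₁)  ≡⟨ cong₂ _+_ (card-restrictLast id F) (card-restrictLast not F) ⟨
  card (restrictLast id F) + card (restrictLast not F) ∎
  where
  open ≡-Reasoning
  F₁ = λ p → F (p ∷ʳ true)
  F₀ = λ p → F (p ∷ʳ false)
  c₁₁ = card (λ p → F (p ∷ʳ true ∷ʳ true))
  c₁₀ = card (λ p → F (p ∷ʳ true ∷ʳ false))
  c₀₁ = card (λ p → F (p ∷ʳ false ∷ʳ true))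
  c₀₀ = card (λ p → F (p ∷ʳ false ∷ʳ false))

weight≤-of-card≤ : ∀ {m} (F : Family (suc m)) (G : Family m) → card F ≤ card G + card G → weight≤ F G
weight≤-of-card≤ {m} F G F≤2G = ≤-trans (*-monoˡ-≤ (2 ^ m) F≤2G) (≤-reflexive (doubling (card G) (2 ^ m)))
  where
  open +-*-Solver
  doubling : ∀ g p → (g + g) * p ≡ g * (2 * p)
  doubling = solve 2 (λ g p → (g :+ g) :* p := g :* (con 2 :* p)) refl

∃-larger-half : ∀ {a ℓ} {A : Set a} (P : A → Set ℓ) (f : A → ℕ) (x y : A) → P x → P y →
  Σ A λ z → P z × f x + f y ≤ f z + f z
∃-larger-half P f x y px py with f x ≤? f y
... | yes fx≤fy = y , py , +-monoˡ-≤ (f y) fx≤fy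
... | no fx≰fy  = x , px , +-monoʳ-≤ (f x) (<⇒≤ (≰⇒> fx≰fy))

∩-∷ʳ : ∀ {n} (p q : Subset n) a b → (p ∷ʳ a) ∩ (q ∷ʳ b) ≡ (p ∩ q) ∷ʳ (a ∧ b)
∩-∷ʳ []      []      a b = refl
∩-∷ʳ (x ∷ p) (y ∷ q) a b = cong (x ∧ y ∷_) (∩-∷ʳ p q a b)

last-∩ : ∀ {n} (p q : Subset (suc n)) → last (p ∩ q) ≡ last p ∧ last q
last-∩ {zero}  (x ∷ []) (y ∷ []) = refl
last-∩ {suc n} (x ∷ p)  (y ∷ q)  = last-∩ p q

∣p∷ʳtrue∣ : ∀ {n} (p : Subset n) → ∣ p ∷ʳ true ∣ ≡ suc ∣ p ∣
∣p∷ʳtrue∣ []          = refl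
∣p∷ʳtrue∣ (true ∷ p)  = cong suc (∣p∷ʳtrue∣ p)
∣p∷ʳtrue∣ (false ∷ p) = ∣p∷ʳtrue∣ p

∣p∷ʳfalse∣ : ∀ {n} (p : Subset n) → ∣ p ∷ʳ false ∣ ≡ ∣ p ∣
∣p∷ʳfalse∣ []          = refl
∣p∷ʳfalse∣ (true ∷ p)  = cong suc (∣p∷ʳfalse∣ p)
∣p∷ʳfalse∣ (false ∷ p) = ∣p∷ʳfalse∣ p

fromℕ∈p∷ʳtrue : ∀ {n} (p : Subset n) → fromℕ n ∈ p ∷ʳ true
fromℕ∈p∷ʳtrue []      = here
fromℕ∈p∷ʳtrue (x ∷ p) = there (fromℕ∈p∷ʳtrue p)

fromℕ∉p∷ʳfalse : ∀ {n} (p : Subset n) → fromℕ n ∉ p ∷ʳ false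
fromℕ∉p∷ʳfalse []      ()
fromℕ∉p∷ʳfalse (x ∷ p) (there h) = fromℕ∉p∷ʳfalse p h

inject₁∈p∷ʳ⁻ : ∀ {n} {x : Fin n} (p : Subset n) b → inject₁ x ∈ p ∷ʳ b → x ∈ p
inject₁∈p∷ʳ⁻ {x = zero}  (_ ∷ p) b here      = here
inject₁∈p∷ʳ⁻ {x = suc x} (_ ∷ p) b (there h) = there (inject₁∈p∷ʳ⁻ p b h)

nonempty-p∷ʳfalse⁻ : ∀ {n} (p : Subset n) → Nonempty (p ∷ʳ false) → Nonempty p
nonempty-p∷ʳfalse⁻ []          (zero , ())
nonempty-p∷ʳfalse⁻ (true ∷ p)  _               = zero , here
nonempty-p∷ʳfalse⁻ (false ∷ p) (suc z , there h) =
  let y , y∈p = nonempty-p∷ʳfalse⁻ p (z , h) in suc y , there y∈p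

⊥∷ʳtrue∷ʳtrue : ∀ n → ⊥ ∷ʳ true ∷ʳ true ≡ ⊥ ∪ ⁅ inject₁ (fromℕ n) ⁆ ∪ ⁅ fromℕ (suc n) ⁆
⊥∷ʳtrue∷ʳtrue zero    = refl
⊥∷ʳtrue∷ʳtrue (suc n) = cong (false ∷_) (⊥∷ʳtrue∷ʳtrue n)

⁅x⁆∷ʳtrue∷ʳtrue : ∀ {n} (x : Fin n) →
  ⁅ x ⁆ ∷ʳ true ∷ʳ true ≡ ⁅ inject₁ (inject₁ x) ⁆ ∪ ⁅ inject₁ (fromℕ n) ⁆ ∪ ⁅ fromℕ (suc n) ⁆
⁅x⁆∷ʳtrue∷ʳtrue {suc n} zero    = cong (true ∷_) (⊥∷ʳtrue∷ʳtrue n)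
⁅x⁆∷ʳtrue∷ʳtrue {suc n} (suc x) = cong (false ∷_) (⁅x⁆∷ʳtrue∷ʳtrue x)

shiftLast : ∀ {n} (p : Subset n) →
  ((p ∷ʳ false ∷ʳ true) - fromℕ (suc n)) ∪ ⁅ inject₁ (fromℕ n) ⁆ ≡ p ∷ʳ true ∷ʳ false
shiftLast []          = refl
shiftLast (true ∷ p)  = cong (true ∷_) (shiftLast p)
shiftLast (false ∷ p) = cong (false ∷_) (shiftLast p)

tight-pair-covers : ∀ {m} {F : Family (suc m)} {C₁ C₂} → LeftCompressed F → ThreeIntersecting F →
  C₁ ∈F F → C₂ ∈F F → ∣ C₁ ∩ C₂ ∣ ≤ 3 → fromℕ m ∈ C₁ → fromℕ m ∈ C₂ → C₁ ∪ C₂ ≡ ⊤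
tight-pair-covers {m} {F} {C₁} {C₂} LC TI C₁∈F C₂∈F ∣C₁∩C₂∣≤3 N∈C₁ N∈C₂ = ⊆-antisym ⊆⊤ (λ {y} _ → covered y)
  where
  N = fromℕ m
  covered : ∀ y → y ∈ C₁ ∪ C₂
  covered y with y ∈? C₁ ∪ C₂
  ... | yes y∈ = y∈
  ... | no  y∉ = ⊥-elim (<⇒≱ ∣D∩C₂∣<3 (TI D C₂ D∈F C₂∈F))
    where
    y∉C₁ : y ∉ C₁
    y∉C₁ = y∉ ∘ x∈p∪q⁺ ∘ inj₁
    y∉C₂ : y ∉ C₂
    y∉C₂ = y∉ ∘ x∈p∪q⁺ ∘ inj₂
    y≢N : y ≢ N
    y≢N refl = y∉C₁ N∈C₁
    D = (C₁ - N) ∪ ⁅ y ⁆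
    D∈F : D ∈F F
    D∈F = LC y N C₁ (Finₚ.≤∧≢⇒< (≤fromℕ y) y≢N) C₁∈F N∈C₁ y∉C₁
    D∩C₂⊆C₁∩C₂ : D ∩ C₂ ⊆ C₁ ∩ C₂
    D∩C₂⊆C₁∩C₂ z∈ with x∈p∩q⁻ D C₂ z∈
    ... | z∈D , z∈C₂ with x∈p∪q⁻ (C₁ - N) ⁅ y ⁆ z∈D
    ...   | inj₁ z∈C₁-N = x∈p∩q⁺ (p─q⊆p C₁ ⁅ N ⁆ z∈C₁-N , z∈C₂)
    ...   | inj₂ z∈⁅y⁆  = ⊥-elim (y∉C₂ (subst (_∈ C₂) (x∈⁅y⁆⇒x≡y y z∈⁅y⁆) z∈C₂))
    N∉D : N ∉ D
    N∉D N∈D with x∈p∪q⁻ (C₁ - N) ⁅ y ⁆ N∈D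
    ... | inj₁ N∈C₁-N = x∉p-x C₁ N N∈C₁-N
    ... | inj₂ N∈⁅y⁆  = y≢N (sym (x∈⁅y⁆⇒x≡y y N∈⁅y⁆))
    ∣D∩C₂∣<3 : ∣ D ∩ C₂ ∣ ℕ.< 3
    ∣D∩C₂∣<3 = ≤-trans (p⊂q⇒∣p∣<∣q∣ (D∩C₂⊆C₁∩C₂ , N , x∈p∩q⁺ (N∈C₁ , N∈C₂) , N∉D ∘ proj₁ ∘ x∈p∩q⁻ D C₂))
                       ∣C₁∩C₂∣≤3

sharpPair-of-∩ : ∀ {m} {F : Family (suc m)} {A₁ A₂} {i j} → LeftCompressed F → ThreeIntersecting F →
  A₁ ∈F F → A₂ ∈F F → A₁ ∩ A₂ ≡ ⁅ i ⁆ ∪ ⁅ j ⁆ ∪ ⁅ fromℕ m ⁆ → SharpPair F i j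
sharpPair-of-∩ {m} {F} {A₁} {A₂} {i} {j} LC TI A₁∈F A₂∈F A₁∩A₂≡S
  with ⊆-minimal F A₁∈F | ⊆-minimal F A₂∈F
... | C₁ , C₁⊆A₁ , min₁@(C₁∈F , _) | C₂ , C₂⊆A₂ , min₂@(C₂∈F , _) =
  C₁ , C₂ , (min₁ , N∈C₁) , (min₂ , N∈C₂) ,
  tight-pair-covers LC TI C₁∈F C₂∈F (≤-trans (≤-reflexive (cong ∣_∣ C₁∩C₂≡S)) ∣S∣≤3) N∈C₁ N∈C₂ ,
  C₁∩C₂≡S
  where
  S = ⁅ i ⁆ ∪ ⁅ j ⁆ ∪ ⁅ fromℕ m ⁆
  ∣S∣≤3 : ∣ S ∣ ≤ 3
  ∣S∣≤3 = begin
    ∣ S ∣                                        ≤⟨ ∣p∪q∣≤∣p∣+∣q∣ ⁅ i ⁆ _ ⟩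
    ∣ ⁅ i ⁆ ∣ + ∣ ⁅ j ⁆ ∪ ⁅ fromℕ m ⁆ ∣            ≤⟨ +-monoʳ-≤ ∣ ⁅ i ⁆ ∣ (∣p∪q∣≤∣p∣+∣q∣ ⁅ j ⁆ _) ⟩
    ∣ ⁅ i ⁆ ∣ + (∣ ⁅ j ⁆ ∣ + ∣ ⁅ fromℕ m ⁆ ∣)      ≡⟨ cong₂ _+_ (∣⁅x⁆∣≡1 i) (cong₂ _+_ (∣⁅x⁆∣≡1 j) (∣⁅x⁆∣≡1 (fromℕ m))) ⟩
    3                                            ∎
    where open ≤-Reasoning
  C₁∩C₂⊆S : C₁ ∩ C₂ ⊆ S
  C₁∩C₂⊆S z∈ = let z∈C₁ , z∈C₂ = x∈p∩q⁻ C₁ C₂ z∈ in subst (_ ∈_) A₁∩A₂≡S (x∈p∩q⁺ (C₁⊆A₁ z∈C₁ , C₂⊆A₂ z∈C₂))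
  C₁∩C₂≡S : C₁ ∩ C₂ ≡ S
  C₁∩C₂≡S = p⊆q∧∣q∣≤∣p∣⇒p≡q C₁∩C₂⊆S (≤-trans ∣S∣≤3 (TI C₁ C₂ C₁∈F C₂∈F))
  N∈C₁∩C₂ : fromℕ m ∈ C₁ ∩ C₂
  N∈C₁∩C₂ = subst (_ ∈_) (sym C₁∩C₂≡S) (x∈p∪q⁺ (inj₂ (x∈p∪q⁺ (inj₂ (x∈⁅x⁆ (fromℕ m))))))
  N∈C₁ = proj₁ (x∈p∩q⁻ C₁ C₂ N∈C₁∩C₂)
  N∈C₂ = proj₂ (x∈p∩q⁻ C₁ C₂ N∈C₁∩C₂)

∩-∷ʳlast : ∀ {n} (p q : Subset (suc n)) → (p ∷ʳ last p) ∩ (q ∷ʳ last q) ≡ (p ∩ q) ∷ʳ last (p ∩ q)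
∩-∷ʳlast p q = trans (∩-∷ʳ p q (last p) (last q)) (cong ((p ∩ q) ∷ʳ_) (sym (last-∩ p q)))

-- Since last is defined through initLast, matching on initLast T also fixes last T.
nonempty-∷ʳlast⁻ : ∀ {n} (T : Subset (suc n)) → Nonempty (T ∷ʳ last T) → Nonempty T
nonempty-∷ʳlast⁻ T ne with initLast T
... | X , true  , refl = fromℕ _ , fromℕ∈p∷ʳtrue X
... | X , false , refl = nonempty-p∷ʳfalse⁻ (X ∷ʳ false) ne

3≤∣p∷ʳlast∣⇒3≤∣p∣ : ∀ {n} (T : Subset (suc n)) → 3 ≤ ∣ T ∷ʳ last T ∣ →
  (∀ x → T ∷ʳ last T ≢ ⁅ x ⁆ ∷ʳ true ∷ʳ true) → 3 ≤ ∣ T ∣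
3≤∣p∷ʳlast∣⇒3≤∣p∣ T 3≤ notSharp with initLast T
... | X , false , refl = subst (3 ≤_) (∣p∷ʳfalse∣ (X ∷ʳ false)) 3≤
... | X , true  , refl rewrite ∣p∷ʳtrue∣ (X ∷ʳ true) | ∣p∷ʳtrue∣ X with ∣ X ∣ ≟ 1
...   | yes ∣X∣≡1 = let x , X≡⁅x⁆ = ∣p∣≡1⇒p≡⁅x⁆ ∣X∣≡1 in ⊥-elim (notSharp x (cong (λ Y → Y ∷ʳ true ∷ʳ true) X≡⁅x⁆))
...   | no  ∣X∣≢1 = s≤s (≤∧≢⇒< (s≤s⁻¹ (s≤s⁻¹ 3≤)) (∣X∣≢1 ∘ sym))

module _ {k} {F : Family (suc (suc k))} where

  threeWise-restrictLast-id : ThreeWiseIntersecting F → ThreeWiseIntersecting (restrictLast id F)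
  threeWise-restrictLast-id TW B₁ B₂ B₃ h₁ h₂ h₃ = nonempty-∷ʳlast⁻ (B₁ ∩ B₂ ∩ B₃)
    (subst Nonempty (trans (cong ((B₁ ∷ʳ last B₁) ∩_) (∩-∷ʳlast B₂ B₃)) (∩-∷ʳlast B₁ (B₂ ∩ B₃)))
      (TW _ _ _ h₁ h₂ h₃))

  threeIntersecting-restrictLast-id : LeftCompressed F → ThreeIntersecting F →
    (∀ x → ¬ SharpPair F (inject₁ (inject₁ x)) (inject₁ (fromℕ k))) → ThreeIntersecting (restrictLast id F)
  threeIntersecting-restrictLast-id LC TI noSharp B₁ B₂ h₁ h₂ = 3≤∣p∷ʳlast∣⇒3≤∣p∣ (B₁ ∩ B₂)
    (subst (λ S → 3 ≤ ∣ S ∣) (∩-∷ʳlast B₁ B₂) (TI _ _ h₁ h₂))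
    (λ x eq → noSharp x (sharpPair-of-∩ LC TI h₁ h₂ (trans (∩-∷ʳlast B₁ B₂) (trans eq (⁅x⁆∷ʳtrue∷ʳtrue x)))))

  restrictLast-not-∩ : LeftCompressed F → ∀ {B} → B ∈F restrictLast not F → ∀ q b → last q ∧ b ≡ false →
    ∃ λ A → A ∈F F × A ∩ (q ∷ʳ b) ≡ (B ∩ q) ∷ʳ false
  restrictLast-not-∩ LC {B} B∈ q b disjoint with initLast B
  ... | X , true  , refl = _ , B∈ , ∩-∷ʳ (X ∷ʳ true) q false b
  restrictLast-not-∩ LC B∈ q false disjoint | X , false , refl = _ , B∈ , ∩-∷ʳ (X ∷ʳ false) q true false
  restrictLast-not-∩ LC B∈ q true  disjoint | X , false , refl with initLast q
  -- the case last q ≡ true is refuted by disjoint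
  ... | Y , false , refl = X ∷ʳ true ∷ʳ false , shifted , meet
    where
    meet : (X ∷ʳ true ∷ʳ false) ∩ (Y ∷ʳ false ∷ʳ true) ≡ ((X ∷ʳ false) ∩ (Y ∷ʳ false)) ∷ʳ false
    meet = begin
      (X ∷ʳ true ∷ʳ false) ∩ (Y ∷ʳ false ∷ʳ true)  ≡⟨ ∩-∷ʳ (X ∷ʳ true) (Y ∷ʳ false) false true ⟩
      ((X ∷ʳ true) ∩ (Y ∷ʳ false)) ∷ʳ false         ≡⟨ cong (_∷ʳ false) (∩-∷ʳ X Y true false) ⟩
      (X ∩ Y) ∷ʳ false ∷ʳ false                     ≡⟨ cong (_∷ʳ false) (∩-∷ʳ X Y false false) ⟨
      ((X ∷ʳ false) ∩ (Y ∷ʳ false)) ∷ʳ false        ∎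
      where open ≡-Reasoning
    shifted : X ∷ʳ true ∷ʳ false ∈F F
    shifted = subst (_∈F F) (shiftLast X)
      (LC (inject₁ (fromℕ k)) (fromℕ (suc k)) _ (ℕ<⇒inject₁< ≤-refl) B∈ (fromℕ∈p∷ʳtrue (X ∷ʳ false))
          (fromℕ∉p∷ʳfalse X ∘ inject₁∈p∷ʳ⁻ (X ∷ʳ false) true))

  threeIntersecting-restrictLast-not : LeftCompressed F → ThreeIntersecting F → ThreeIntersecting (restrictLast not F)
  threeIntersecting-restrictLast-not LC TI B₁ B₂ h₁ h₂ =
    let A , A∈F , A∩B₂′≡ = restrictLast-not-∩ LC h₁ B₂ (not (last B₂)) (∧-inverseʳ (last B₂))
    in subst (3 ≤_) (trans (cong ∣_∣ A∩B₂′≡) (∣p∷ʳfalse∣ (B₁ ∩ B₂))) (TI _ _ A∈F h₂)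

  threeWise-restrictLast-not : LeftCompressed F → ThreeWiseIntersecting F → ThreeWiseIntersecting (restrictLast not F)
  threeWise-restrictLast-not LC TW B₁ B₂ B₃ h₁ h₂ h₃ =
    let A , A∈F , A∩B₂₃′≡ = restrictLast-not-∩ LC h₁ (B₂ ∩ B₃) (not (last B₂) ∧ not (last B₃)) disjoint
    in nonempty-p∷ʳfalse⁻ (B₁ ∩ B₂ ∩ B₃)
         (subst Nonempty (trans (cong (A ∩_) (∩-∷ʳ B₂ B₃ _ _)) A∩B₂₃′≡) (TW _ _ _ A∈F h₂ h₃))
    where
    disjoint : last (B₂ ∩ B₃) ∧ (not (last B₂) ∧ not (last B₃)) ≡ false
    disjoint rewrite last-∩ B₂ B₃ with last B₂ | last B₃
    ... | true  | true  = refl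
    ... | true  | false = refl
    ... | false | _     = refl

lemma1 : (m : ℕ) → 1 ≤ m → (F : Family (suc m)) →
    LeftCompressed F → UpSet F → ThreeWiseIntersecting F → ThreeIntersecting F →
    ((i j : Fin (suc m)) → toℕ j ≡ m ∸ 1 → i < j → ¬ SharpPair F i j) →
    Σ (Family m) (λ G → ThreeWiseIntersecting G × ThreeIntersecting G × weight≤ F G)
lemma1 (suc k) _ F LC _ TW TI noSharp =
  let G , (TW-G , TI-G) , F≤2G = ∃-larger-half (λ G → ThreeWiseIntersecting G × ThreeIntersecting G) card
        (restrictLast id F) (restrictLast not F)
        (threeWise-restrictLast-id TW , threeIntersecting-restrictLast-id LC TI noSharp-below-last)
        (threeWise-restrictLast-not LC TW , threeIntersecting-restrictLast-not LC TI)
  in G , TW-G , TI-G , weight≤-of-card≤ F G (≤-trans (≤-reflexive (card≡card-restrictLast F)) F≤2G)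
  where
  toℕ-last : toℕ (inject₁ (fromℕ k)) ≡ k
  toℕ-last = trans (toℕ-inject₁ (fromℕ k)) (toℕ-fromℕ k)
  noSharp-below-last : ∀ x → ¬ SharpPair F (inject₁ (inject₁ x)) (inject₁ (fromℕ k))
  noSharp-below-last x = noSharp _ _ toℕ-last
    (subst₂ ℕ._<_ (sym (trans (toℕ-inject₁ (inject₁ x)) (toℕ-inject₁ x))) (sym toℕ-last) (toℕ<n x))
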